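{- Let $(X,A,m,\alpha)$ be a micro-macro system and let $0\le\varepsilon$. Suppose the system has an $\varepsilon$-dominant equilibrium, i.e. $\frac{|X^{\mathrm{eq}}|}{|X|}\ge 1-\varepsilon$. Then $\frac{|D|}{|X|}\le\varepsilon$, $\frac{|I|}{|X|}\le\varepsilon$, and $\frac{|C|}{|X|}\ge 1-2\varepsilon$.
   Context: A micro-macro system $(X,A,m,\alpha)$ consists of finite sets $X$ (microstates) and $A$ (macrostates), a bijection $\alpha:X\to X$ and a surjection $m:X\to A$. For $a\in A$ write $|a|=|m^{ -1}(a)|$, and for $i\in X$ write $|i|=|m(i)|$. The Boltzmann entropy is $S(a)=\ln|a|$ for $a\in A$ and $S(i)=\ln|m(i)|$ for $i\in X$. Set $D=\{i\in X: S(\alpha i)<S(i)\}$, $C=\{i\in X: S(\alpha i)=S(i)\}$, $I=\{i\in X: S(\alpha i)>S(i)\}$. $X^{\mathrm{eq}}$ is the set of microstates $i$ such that $m(i)$ is a macrostate of maximal entropy (maximal $|a|$).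
   Formalization: The parameter ε is taken to be a nonnegative rational number. -}

module Defs where

open import Data.Nat using (ℕ; _≤_; _<_; _≤?_; _<?_)
open import Data.Fin using (Fin; _≟_)
open import Data.Fin.Properties using (all?)
open import Data.List using (length; filter)
open import Data.List.Base using (allFin)
open import Data.Nat.Properties using (_≟_)
open import Relation.Nullary using (Dec)
open import Relation.Unary using (Pred; Decidable)
open import Relation.Binary.PropositionalEquality using (_≡_)
open import Data.Product using (∃)
open import Level using (0ℓ)

card : {n : ℕ} {P : Pred (Fin n) 0ℓ} → Decidable P → ℕ
card {n} P? = length (filter P? (allFin n))

IsSurjection : {n k : ℕ} → (Fin n → Fin k) → Set
IsSurjection {n} {k} m = ∀ (a : Fin k) → ∃ λ (i : Fin n) → m i ≡ a

module MicroMacro {n k : ℕ} (m : Fin n → Fin k) (α : Fin n → Fin n) where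

  ∣_∣ₐ : Fin k → ℕ
  ∣ a ∣ₐ = card (λ i → m i Data.Fin.≟ a)

  ∣_∣ₓ : Fin n → ℕ
  ∣ i ∣ₓ = ∣ m i ∣ₐ

  -- S = ln |·| is strictly increasing, so comparisons of entropies
  -- are comparisons of the sizes |·|.
  InD : Pred (Fin n) 0ℓ
  InD i = ∣ α i ∣ₓ < ∣ i ∣ₓ

  InC : Pred (Fin n) 0ℓ
  InC i = ∣ α i ∣ₓ ≡ ∣ i ∣ₓ

  InI : Pred (Fin n) 0ℓ
  InI i = ∣ i ∣ₓ < ∣ α i ∣ₓ

  InXeq : Pred (Fin n) 0ℓ
  InXeq i = ∀ (b : Fin k) → ∣ b ∣ₐ ≤ ∣ i ∣ₓ

  InD? : Decidable InD
  InD? i = ∣ α i ∣ₓ <? ∣ i ∣ₓ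

  InC? : Decidable InC
  InC? i = ∣ α i ∣ₓ Data.Nat.Properties.≟ ∣ i ∣ₓ

  InI? : Decidable InI
  InI? i = ∣ i ∣ₓ <? ∣ α i ∣ₓ

  InXeq? : Decidable InXeq
  InXeq? i = all? (λ b → ∣ b ∣ₐ ≤? ∣ i ∣ₓ)

  ∣D∣ ∣C∣ ∣I∣ ∣Xeq∣ : ℕ
  ∣D∣ = card InD?
  ∣C∣ = card InC?
  ∣I∣ = card InI?
  ∣Xeq∣ = card InXeq?

module Submission where

-- A microstate whose image under α is an equilibrium state cannot lose entropy, and an
-- equilibrium microstate cannot gain any: D ⊆ α⁻¹(X ∖ Xeq) and I ⊆ X ∖ Xeq. As α is a
-- bijection, both sets have at most |X ∖ Xeq| ≤ ε|X| elements, and since D, I and C cover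
-- X, |C| ≥ |X| − |D| − |I| ≥ (1 − 2ε)|X|.

open import Defs
open import Data.Nat using (ℕ; NonZero)
open import Data.Fin using (Fin)
open import Data.Integer using (+_)
open import Data.Rational using (ℚ; 0ℚ; 1ℚ; _≤_; _/_; _-_; _*_)
open import Data.Product using (_×_)
open import Function.Bundles using (_⤖_; Bijection)

open import Data.Nat as ℕ using (suc; z≤n; s≤s)
import Data.Nat.Properties as ℕ
open import Data.Integer as ℤ using ()
import Data.Integer.Properties as ℤ
import Data.Integer.Solver
open import Data.Rational using (_+_; toℚᵘ)
open import Data.Rational.Properties
  using (toℚᵘ-fromℚᵘ; toℚᵘ-injective; toℚᵘ-homo-+; toℚᵘ-cancel-≤; +-mono-≤; neg-antimono-≤)
import Data.Rational.Solver
open import Data.Rational.Unnormalised as ℚᵘ using (_≃_; *≡*; *≤*) renaming (_/_ to _/ᵘ_)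
import Data.Rational.Unnormalised.Properties as ℚᵘ
open import Data.List using ([]; _∷_; length; filter; map; allFin)
open import Data.List.Properties using (length-tabulate)
open import Data.List.Membership.Propositional using (_∈_)
open import Data.List.Membership.Propositional.Properties using (∈-allFin; ∈-map⁺)
open import Data.List.Membership.Propositional.Properties.WithK using (unique∧set⇒bag)
open import Data.List.Relation.Binary.BagAndSetEquality using (∼bag⇒↭)
open import Data.List.Relation.Binary.Permutation.Propositional using (_↭_)
open import Data.List.Relation.Binary.Permutation.Propositional.Properties using (filter-↭; ↭-length)
open import Data.List.Relation.Binary.Sublist.Propositional as Sublist using (_∷ʳ_; ⊆-refl)
open import Data.List.Relation.Binary.Sublist.Propositional.Properties using (filter⁺; length-mono-≤)
import Data.List.Relation.Unary.Unique.Propositional.Properties as Unique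
open import Data.Product using (_,_)
open import Data.Sum using (inj₁; inj₂; [_,_])
open import Function using (_∘_; mk⇔)
open import Level using (Level; 0ℓ)
open import Relation.Nullary using (yes; no; contradiction)
open import Relation.Unary using (Pred; Decidable; _⊆_; _∪_; ∁)
open import Relation.Unary.Properties using (∁?)
open import Relation.Binary.PropositionalEquality using (_≡_; refl; sym; trans; cong; module ≡-Reasoning)

private
  variable
    a p q r : Level
    A B : Set a

module _ {P : Pred A p} (P? : Decidable P) where

  length-filter-mono : {Q : Pred A q} (Q? : Decidable Q) → P ⊆ Q →
    ∀ {xs ys} → xs Sublist.⊆ ys → length (filter P? xs) ℕ.≤ length (filter Q? ys)
  length-filter-mono Q? P⊆Q xs⊆ys = length-mono-≤ (filter⁺ P? Q? (λ { refl → P⊆Q }) xs⊆ys)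

  length-filter-∷ : ∀ x xs → length (filter P? xs) ℕ.≤ length (filter P? (x ∷ xs))
  length-filter-∷ x xs = length-filter-mono P? (λ px → px) (x ∷ʳ ⊆-refl)

  length-filter-∁ : ∀ xs → length (filter P? xs) ℕ.+ length (filter (∁? P?) xs) ≡ length xs
  length-filter-∁ [] = refl
  length-filter-∁ (x ∷ xs) with P? x
  ... | yes _ = cong suc (length-filter-∁ xs)
  ... | no _  = trans (ℕ.+-suc _ _) (cong suc (length-filter-∁ xs))

length-filter-∘ : (f : A → B) {P : Pred B p} (P? : Decidable P) → ∀ xs →
  length (filter (P? ∘ f) xs) ≡ length (filter P? (map f xs))
length-filter-∘ f P? [] = refl
length-filter-∘ f P? (x ∷ xs) with P? (f x)
... | yes _ = cong suc (length-filter-∘ f P? xs)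
... | no _  = length-filter-∘ f P? xs

module _ {P : Pred A p} {Q : Pred A q} {R : Pred A r}
         (P? : Decidable P) (Q? : Decidable Q) (R? : Decidable R) where

  length-filter-∪ : P ⊆ Q ∪ R → ∀ xs →
    length (filter P? xs) ℕ.≤ length (filter Q? xs) ℕ.+ length (filter R? xs)
  length-filter-∪ P⊆Q∪R [] = z≤n
  length-filter-∪ P⊆Q∪R (x ∷ xs) with ih ← length-filter-∪ P⊆Q∪R xs | P? x
  ... | no _  = ℕ.≤-trans ih (ℕ.+-mono-≤ (length-filter-∷ Q? x xs) (length-filter-∷ R? x xs))
  ... | yes px with Q? x | R? x
  ...   | yes _  | yes _  = s≤s (ℕ.≤-trans ih (ℕ.+-monoʳ-≤ _ (ℕ.n≤1+n _)))
  ...   | yes _  | no _   = s≤s ih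
  ...   | no _   | yes _  = ℕ.≤-trans (s≤s ih) (ℕ.≤-reflexive (sym (ℕ.+-suc _ _)))
  ...   | no ¬qx | no ¬rx = contradiction (P⊆Q∪R px) [ ¬qx , ¬rx ]

card-mono : ∀ {n} {P Q : Pred (Fin n) 0ℓ} (P? : Decidable P) (Q? : Decidable Q) →
  P ⊆ Q → card P? ℕ.≤ card Q?
card-mono {n} P? Q? P⊆Q = length-filter-mono P? Q? P⊆Q {allFin n} ⊆-refl

card-∪ : ∀ {n} {P Q R : Pred (Fin n) 0ℓ} (P? : Decidable P) (Q? : Decidable Q) (R? : Decidable R) →
  P ⊆ Q ∪ R → card P? ℕ.≤ card Q? ℕ.+ card R?
card-∪ {n} P? Q? R? P⊆Q∪R = length-filter-∪ P? Q? R? P⊆Q∪R (allFin n)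

card-∁ : ∀ {n} {P : Pred (Fin n) 0ℓ} (P? : Decidable P) → card P? ℕ.+ card (∁? P?) ≡ n
card-∁ {n} P? = trans (length-filter-∁ P? (allFin n)) (length-tabulate (λ i → i))

map-allFin-↭ : ∀ {n} (f : Fin n ⤖ Fin n) → map (Bijection.to f) (allFin n) ↭ allFin n
map-allFin-↭ {n} f = ∼bag⇒↭ (unique∧set⇒bag (Unique.map⁺ injective (Unique.allFin⁺ n))
                                            (Unique.allFin⁺ n)
                                            (mk⇔ (λ _ → ∈-allFin _) ∈-map-allFin))
  where
  open Bijection f
  ∈-map-allFin : ∀ {y} → y ∈ allFin n → y ∈ map to (allFin n)
  ∈-map-allFin {y} _ with x , refl ← strictlySurjective y = ∈-map⁺ to (∈-allFin x)

card-∘-bijection : ∀ {n} (f : Fin n ⤖ Fin n) {P : Pred (Fin n) 0ℓ} (P? : Decidable P) →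
  card (P? ∘ Bijection.to f) ≡ card P?
card-∘-bijection {n} f P? = trans (length-filter-∘ (Bijection.to f) P? (allFin n))
                                  (↭-length (filter-↭ P? (map-allFin-↭ f)))

-- Normalised fractions are computed through a gcd, so their arithmetic is done in ℚᵘ.
toℚᵘ-/ : ∀ i n .{{_ : NonZero n}} → toℚᵘ (i / n) ≃ i /ᵘ n
toℚᵘ-/ i (suc n) = toℚᵘ-fromℚᵘ (ℚᵘ.mkℚᵘ i n)

/ᵘ-+ : ∀ i j n .{{_ : NonZero n}} → i /ᵘ n ℚᵘ.+ j /ᵘ n ≃ (i ℤ.+ j) /ᵘ n
/ᵘ-+ i j n@(suc _) = *≡* (begin
  (i ℤ.* d ℤ.+ j ℤ.* d) ℤ.* d ≡⟨ solve 3 (λ i j d → (i :* d :+ j :* d) :* d := (i :+ j) :* (d :* d)) refl i j d ⟩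
  (i ℤ.+ j) ℤ.* (d ℤ.* d)     ≡⟨ cong ((i ℤ.+ j) ℤ.*_) (ℤ.pos-* n n) ⟨
  (i ℤ.+ j) ℤ.* + (n ℕ.* n)   ∎)
  where
  open ≡-Reasoning
  open Data.Integer.Solver.+-*-Solver
  d = + n

/-+ : ∀ i j n .{{_ : NonZero n}} → i / n + j / n ≡ (i ℤ.+ j) / n
/-+ i j n = toℚᵘ-injective (begin
  toℚᵘ (i / n + j / n)             ≈⟨ toℚᵘ-homo-+ (i / n) (j / n) ⟩
  toℚᵘ (i / n) ℚᵘ.+ toℚᵘ (j / n)   ≈⟨ ℚᵘ.+-cong (toℚᵘ-/ i n) (toℚᵘ-/ j n) ⟩
  i /ᵘ n ℚᵘ.+ j /ᵘ n               ≈⟨ /ᵘ-+ i j n ⟩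
  (i ℤ.+ j) /ᵘ n                   ≈⟨ toℚᵘ-/ (i ℤ.+ j) n ⟨
  toℚᵘ ((i ℤ.+ j) / n)             ∎)
  where open ℚᵘ.≃-Reasoning

/-monoˡ-≤ : ∀ {i j} n .{{_ : NonZero n}} → i ℤ.≤ j → i / n ≤ j / n
/-monoˡ-≤ {i} {j} n@(suc _) i≤j = toℚᵘ-cancel-≤ (begin
  toℚᵘ (i / n) ≃⟨ toℚᵘ-/ i n ⟩
  i /ᵘ n       ≤⟨ *≤* (ℤ.*-monoʳ-≤-nonNeg (+ n) i≤j) ⟩
  j /ᵘ n       ≃⟨ toℚᵘ-/ j n ⟨
  toℚᵘ (j / n) ∎)
  where open ℚᵘ.≤-Reasoning

n/n≡1 : ∀ n .{{_ : NonZero n}} → (+ n) / n ≡ 1ℚ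
n/n≡1 n@(suc _) = toℚᵘ-injective (ℚᵘ.≃-trans (toℚᵘ-/ (+ n) n) (*≡* (ℤ.*-comm (+ n) (+ 1))))

module _ {n : ℕ} .{{_ : NonZero n}} where

  open Data.Rational.Properties.≤-Reasoning
  open Data.Rational.Solver.+-*-Solver

  pos/-+ : ∀ a b → (+ a) / n + (+ b) / n ≡ (+ (a ℕ.+ b)) / n
  pos/-+ a b = trans (/-+ (+ a) (+ b) n) (cong (_/ n) (sym (ℤ.pos-+ a b)))

  pos/-mono-≤ : ∀ {a b} → a ℕ.≤ b → (+ a) / n ≤ (+ b) / n
  pos/-mono-≤ a≤b = /-monoˡ-≤ n (ℤ.+≤+ a≤b)

  fraction-≤-complement : ∀ a b ε → a ℕ.+ b ℕ.≤ n →
    1ℚ - ε ≤ (+ a) / n → (+ b) / n ≤ ε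
  fraction-≤-complement a b ε a+b≤n 1-ε≤a = begin
    (+ b) / n                             ≡⟨ solve 2 (λ a b → b := (a :+ b) :- a) refl ((+ a) / n) ((+ b) / n) ⟩
    ((+ a) / n + (+ b) / n) - (+ a) / n   ≤⟨ +-mono-≤ a+b≤1 (neg-antimono-≤ 1-ε≤a) ⟩
    1ℚ - (1ℚ - ε)                         ≡⟨ solve 1 (λ e → con 1ℚ :- (con 1ℚ :- e) := e) refl ε ⟩
    ε                                     ∎
    where
    a+b≤1 : (+ a) / n + (+ b) / n ≤ 1ℚ
    a+b≤1 = begin
      (+ a) / n + (+ b) / n   ≡⟨ pos/-+ a b ⟩
      (+ (a ℕ.+ b)) / n       ≤⟨ pos/-mono-≤ a+b≤n ⟩
      (+ n) / n               ≡⟨ n/n≡1 n ⟩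
      1ℚ                      ∎

  fraction-≥-cover : ∀ a b c ε → n ℕ.≤ a ℕ.+ b ℕ.+ c →
    (+ a) / n ≤ ε → (+ b) / n ≤ ε → 1ℚ - ((+ 2) / 1) * ε ≤ (+ c) / n
  fraction-≥-cover a b c ε n≤a+b+c a≤ε b≤ε = begin
    1ℚ - ((+ 2) / 1) * ε          ≡⟨ solve 1 (λ e → con 1ℚ :- con ((+ 2) / 1) :* e := con 1ℚ :- (e :+ e)) refl ε ⟩
    1ℚ - (ε + ε)                  ≤⟨ +-mono-≤ 1≤a+b+c (neg-antimono-≤ (+-mono-≤ a≤ε b≤ε)) ⟩
    (x + y + z) - (x + y)         ≡⟨ solve 3 (λ x y z → (x :+ y :+ z) :- (x :+ y) := z) refl x y z ⟩
    z                             ∎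
    where
    x = (+ a) / n
    y = (+ b) / n
    z = (+ c) / n
    1≤a+b+c : 1ℚ ≤ x + y + z
    1≤a+b+c = begin
      1ℚ                          ≡⟨ n/n≡1 n ⟨
      (+ n) / n                   ≤⟨ pos/-mono-≤ n≤a+b+c ⟩
      (+ (a ℕ.+ b ℕ.+ c)) / n     ≡⟨ pos/-+ (a ℕ.+ b) c ⟨
      (+ (a ℕ.+ b)) / n + z       ≡⟨ cong (_+ z) (pos/-+ a b) ⟨
      x + y + z                   ∎

module MicroMacroCounts {n k : ℕ} (m : Fin n → Fin k) (α : Fin n ⤖ Fin n) where

  open Bijection α using (to)
  open MicroMacro m to public

  D⊆α⁻¹[X∖Xeq] : InD ⊆ ∁ InXeq ∘ to
  D⊆α⁻¹[X∖Xeq] {i} αi<i αi∈Xeq = ℕ.<⇒≱ αi<i (αi∈Xeq (m i))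

  I⊆X∖Xeq : InI ⊆ ∁ InXeq
  I⊆X∖Xeq {i} i<αi i∈Xeq = ℕ.<⇒≱ i<αi (i∈Xeq (m (to i)))

  X∖D⊆I∪C : ∁ InD ⊆ InI ∪ InC
  X∖D⊆I∪C αi≮i with ℕ.m≤n⇒m<n∨m≡n (ℕ.≮⇒≥ αi≮i)
  ... | inj₁ i<αi = inj₁ i<αi
  ... | inj₂ i≡αi = inj₂ (sym i≡αi)

  ∣Xeq∣+∣D∣≤n : ∣Xeq∣ ℕ.+ ∣D∣ ℕ.≤ n
  ∣Xeq∣+∣D∣≤n = begin
    ∣Xeq∣ ℕ.+ ∣D∣                          ≤⟨ ℕ.+-monoʳ-≤ ∣Xeq∣ (card-mono InD? (∁? InXeq? ∘ to) D⊆α⁻¹[X∖Xeq]) ⟩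
    ∣Xeq∣ ℕ.+ card (∁? InXeq? ∘ to)          ≡⟨ cong (∣Xeq∣ ℕ.+_) (card-∘-bijection α (∁? InXeq?)) ⟩
    ∣Xeq∣ ℕ.+ card (∁? InXeq?)              ≡⟨ card-∁ InXeq? ⟩
    n                                      ∎
    where open ℕ.≤-Reasoning

  ∣Xeq∣+∣I∣≤n : ∣Xeq∣ ℕ.+ ∣I∣ ℕ.≤ n
  ∣Xeq∣+∣I∣≤n = begin
    ∣Xeq∣ ℕ.+ ∣I∣                ≤⟨ ℕ.+-monoʳ-≤ ∣Xeq∣ (card-mono InI? (∁? InXeq?) I⊆X∖Xeq) ⟩
    ∣Xeq∣ ℕ.+ card (∁? InXeq?)    ≡⟨ card-∁ InXeq? ⟩
    n                            ∎
    where open ℕ.≤-Reasoning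

  n≤∣D∣+∣I∣+∣C∣ : n ℕ.≤ ∣D∣ ℕ.+ ∣I∣ ℕ.+ ∣C∣
  n≤∣D∣+∣I∣+∣C∣ = begin
    n                          ≡⟨ card-∁ InD? ⟨
    ∣D∣ ℕ.+ card (∁? InD?)      ≤⟨ ℕ.+-monoʳ-≤ ∣D∣ (card-∪ (∁? InD?) InI? InC? X∖D⊆I∪C) ⟩
    ∣D∣ ℕ.+ (∣I∣ ℕ.+ ∣C∣)        ≡⟨ ℕ.+-assoc ∣D∣ ∣I∣ ∣C∣ ⟨
    ∣D∣ ℕ.+ ∣I∣ ℕ.+ ∣C∣          ∎
    where open ℕ.≤-Reasoning

proposition1 : (n k : ℕ) .{{_ : NonZero n}} (m : Fin n → Fin k) (α : Fin n ⤖ Fin n) →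
    IsSurjection m → (ε : ℚ) → 0ℚ ≤ ε →
    let open MicroMacro m (Bijection.to α) in
    1ℚ - ε ≤ (+ ∣Xeq∣) / n →
    ((+ ∣D∣) / n ≤ ε) × ((+ ∣I∣) / n ≤ ε) × (1ℚ - ((+ 2) / 1) * ε ≤ (+ ∣C∣) / n)
proposition1 n k m α _ ε _ 1-ε≤Xeq = D≤ε , I≤ε , fraction-≥-cover ∣D∣ ∣I∣ ∣C∣ ε n≤∣D∣+∣I∣+∣C∣ D≤ε I≤ε
  where
  open MicroMacroCounts m α
  D≤ε : (+ ∣D∣) / n ≤ ε
  D≤ε = fraction-≤-complement ∣Xeq∣ ∣D∣ ε ∣Xeq∣+∣D∣≤n 1-ε≤Xeq
  I≤ε : (+ ∣I∣) / n ≤ ε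
  I≤ε = fraction-≤-complement ∣Xeq∣ ∣I∣ ε ∣Xeq∣+∣I∣≤n 1-ε≤Xeq
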